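{- Let $T_n$ be a tree on $n$ vertices and let $k$ be an integer with $0\le k\le n-2$. Then $\phi_k(T_n)=2$.
   Context: For a graph $G$ and a vertex coloring $c:V(G)\to\{1,\dots,\ell\}$ (not required to be proper or surjective), an edge $uv$ is called bad if $c(u)=c(v)$. For an integer $k\ge 0$, the $k$-defect number $\phi_k(G)$ is the smallest positive integer $\ell$ such that there is a coloring $c:V(G)\to\{1,\dots,\ell\}$ with exactly $k$ bad edges; if no coloring (with any number of colors) has exactly $k$ bad edges, then $\phi_k(G)=0$ by convention. -}

module Defs where

open import Data.Nat using (ℕ; zero; suc; _≤_; _<_)
open import Data.Bool using (Bool; true; false)
open import Data.Fin using (Fin; zero; suc; inject₁; fromℕ; toℕ) renaming (_<_ to _<ᶠ_; _<?_ to _<ᶠ?_)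
open import Data.Fin.Properties using () renaming (_≟_ to _≟ᶠ_)
open import Data.Bool.Properties using () renaming (_≟_ to _≟ᵇ_)
open import Data.List using (List; length; filter; cartesianProduct; allFin)
open import Data.Product using (Σ; _×_; _,_; ∃; ∃-syntax)
open import Relation.Binary.PropositionalEquality using (_≡_; _≢_)
open import Relation.Nullary using (¬_)
open import Relation.Nullary.Decidable using (_×-dec_)
open import Function.Definitions using (Injective)

record Graph (n : ℕ) : Set where
  field
    adj     : Fin n → Fin n → Bool
    adj-sym : ∀ u v → adj u v ≡ adj v u
    adj-irr : ∀ u → adj u u ≡ false

open Graph public

Adj : ∀ {n} → Graph n → Fin n → Fin n → Set
Adj G u v = adj G u v ≡ true

data Walk {n : ℕ} (G : Graph n) : Fin n → Fin n → Set where
  stay : ∀ {u} → Walk G u u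
  step : ∀ {u v w} → Adj G u v → Walk G v w → Walk G u w

Connected : ∀ {n} → Graph n → Set
Connected G = ∀ u v → Walk G u v

-- A cycle of length m + 3: distinct vertices v 0, ..., v (m+2), consecutive
-- ones adjacent and the last adjacent to the first.
record Cycle {n : ℕ} (G : Graph n) : Set where
  field
    m     : ℕ
    vtx   : Fin (suc (suc (suc m))) → Fin n
    inj   : Injective _≡_ _≡_ vtx
    cons  : ∀ (i : Fin (suc (suc m))) → Adj G (vtx (inject₁ i)) (vtx (suc i))
    close : Adj G (vtx (fromℕ (suc (suc m)))) (vtx zero)

Acyclic : ∀ {n} → Graph n → Set
Acyclic G = ¬ Cycle G

-- A tree: connected and acyclic (on n vertices; n ≥ 1 is required by
-- the hypotheses of the theorem below anyway).
IsTree : ∀ {n} → Graph n → Set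
IsTree G = Connected G × Acyclic G

-- Colorings with ℓ colours: Fin n → Fin ℓ (colours {1..ℓ} ↦ Fin ℓ).
-- Number of bad edges: edges uv (counted once, via u < v) with c u = c v.
badEdges : ∀ {n ℓ} → Graph n → (Fin n → Fin ℓ) → ℕ
badEdges {n} G c =
  length (filter (λ p → (Data.Product.proj₁ p <ᶠ? Data.Product.proj₂ p)
                        ×-dec (adj G (Data.Product.proj₁ p) (Data.Product.proj₂ p) ≟ᵇ true)
                        ×-dec (c (Data.Product.proj₁ p) ≟ᶠ c (Data.Product.proj₂ p)))
                 (cartesianProduct (allFin n) (allFin n)))

HasColoring : ∀ {n} → Graph n → ℕ → ℕ → Set
HasColoring G k ℓ = Σ (Fin _ → Fin ℓ) (λ c → badEdges G c ≡ k)

-- φ_k(G) = φ, as in the paper: either φ is the least positive ℓ admitting an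
-- ℓ-colouring with exactly k bad edges, or φ = 0 and no colouring (with any
-- number of colours) has exactly k bad edges.
DefectNumber : ∀ {n} → Graph n → ℕ → ℕ → Set
DefectNumber G k zero = ∀ ℓ → ¬ HasColoring G k ℓ
DefectNumber G k (suc φ) =
  HasColoring G k (suc φ) × (∀ ℓ → 1 ≤ ℓ → ℓ < suc φ → ¬ HasColoring G k ℓ)

-- A tree grows from a single vertex by repeatedly attaching a pendant vertex, whose only
-- neighbour in the current subtree is its parent (a second one would close a cycle). The new
-- edge is monochromatic exactly when the leaf receives its parent's colour, so by induction a
-- subtree with t edges realises every number j ≤ t of monochromatic edges with two colours.
-- With one colour all n − 1 edges of the tree are bad, so for k ≤ n − 2 one colour never suffices.

module Submission where

open import Defs
open import Data.Nat using (ℕ; _≤_; _+_; zero; suc; z≤n; s≤s; _<_)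
open import Data.Nat.Properties using (+-suc; +-comm; +-identityʳ; ≤-refl; <-irrefl; <⇒≤; m≤n⇒m<n∨m≡n)
open import Data.Bool using (Bool; true; false)
open import Data.Bool.Properties using () renaming (_≟_ to _≟ᵇ_)
open import Data.Fin using (Fin; zero; suc; inject₁; fromℕ) renaming (_<_ to _<ᶠ_; _<?_ to _<ᶠ?_)
open import Data.Fin.Properties using (_≟_; <-cmp; <-asym; any?) renaming (<-irrefl to <ᶠ-irrefl)
open import Data.List using (List; []; _∷_; length; filter; cartesianProduct; allFin; lookup)
open import Data.List.Properties using (filter-none; filter-all; filter-≐; filter-notAll; length-tabulate)
open import Data.List.Relation.Unary.Any using (here; there)
import Data.List.Relation.Unary.Any as Any
open import Data.List.Relation.Unary.All using (All; []; _∷_; universal)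
import Data.List.Relation.Unary.All as All
open import Data.List.Relation.Unary.All.Properties using (¬Any⇒All¬)
open import Data.List.Relation.Unary.AllPairs using ([]; _∷_)
open import Data.List.Relation.Unary.Unique.Propositional using (Unique)
open import Data.List.Relation.Unary.Unique.Propositional.Properties using (cartesianProduct⁺; allFin⁺)
open import Data.List.Membership.Propositional using (_∈_)
open import Data.List.Membership.Propositional.Properties using (∈-allFin; ∈-cartesianProduct⁺; ∈-lookup)
open import Data.Product using (_×_; _,_; ∃; ∃₂; proj₁; proj₂)
open import Data.Sum using (_⊎_; inj₁; inj₂)
open import Data.Vec.Functional using (updateAt)
open import Data.Vec.Functional.Properties using (updateAt-updates; updateAt-minimal)
open import Function using (id; _∘_)
open import Level using (0ℓ)
open import Relation.Binary.PropositionalEquality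
open import Relation.Nullary using (¬_; Dec; yes; no; ¬?; contradiction)
open import Relation.Nullary.Decidable using (_×-dec_; decidable-stable)
open import Relation.Unary using (Pred; Decidable; _⊆_; _∩_; ∁)
open import Relation.Unary.Properties using (_∩?_; ∁?)
open import Relation.Binary using (tri<; tri≈; tri>)

module _ {A : Set} {P Q : Pred A 0ℓ} (P? : Decidable P) (Q? : Decidable Q) where

  length-filter-⊆ : Q ⊆ P → ∀ xs →
    length (filter P? xs) ≡ length (filter Q? xs) + length (filter (P? ∩? ∁? Q?) xs)
  length-filter-⊆ Q⊆P [] = refl
  length-filter-⊆ Q⊆P (x ∷ xs) with P? x | Q? x
  ... | yes _  | yes _  = cong suc (length-filter-⊆ Q⊆P xs)
  ... | yes _  | no _   = trans (cong suc (length-filter-⊆ Q⊆P xs)) (sym (+-suc _ _))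
  ... | no ¬px | yes qx = contradiction (Q⊆P qx) ¬px
  ... | no _   | no _   = length-filter-⊆ Q⊆P xs

module _ {A : Set} {P : Pred A 0ℓ} (P? : Decidable P) where

  length-filter-none : ∀ {xs} → All (∁ P) xs → length (filter P? xs) ≡ 0
  length-filter-none ¬P = cong length (filter-none P? ¬P)

  length-filter-≡1 : ∀ {x xs} → Unique xs → x ∈ xs → P x → (∀ {y} → P y → y ≡ x) →
                     length (filter P? xs) ≡ 1
  length-filter-≡1 {xs = y ∷ xs} (y∉xs ∷ !xs) x∈ px only with P? y
  ... | yes py = cong suc (length-filter-none (All.map (λ y≢z pz → y≢z (trans (only py) (sym (only pz)))) y∉xs))
  ... | no ¬py with x∈
  ...   | here refl = contradiction px ¬py
  ...   | there x∈xs = length-filter-≡1 !xs x∈xs px only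

lookup-injective : ∀ {A : Set} {xs : List A} → Unique xs → ∀ {i j} → lookup xs i ≡ lookup xs j → i ≡ j
lookup-injective (_ ∷ _)    {zero}  {zero}  _  = refl
lookup-injective (x∉ ∷ _)   {zero}  {suc j} eq = contradiction eq (All.lookup x∉ (∈-lookup j))
lookup-injective (x∉ ∷ _)   {suc i} {zero}  eq = contradiction (sym eq) (All.lookup x∉ (∈-lookup i))
lookup-injective (_ ∷ !xs)  {suc i} {suc j} eq = cong suc (lookup-injective !xs eq)

other : Fin 2 → Fin 2
other zero    = suc zero
other (suc _) = zero

other-≢ : ∀ x → x ≢ other x
other-≢ zero       ()
other-≢ (suc zero) ()

VertexSet : ℕ → Set
VertexSet n = Fin n → Bool

module _ {n : ℕ} where

  _∈ᵛ_ : Fin n → VertexSet n → Set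
  v ∈ᵛ S = S v ≡ true

  _∈ᵛ?_ : ∀ v S → Dec (v ∈ᵛ S)
  v ∈ᵛ? S = S v ≟ᵇ true

  insert : Fin n → VertexSet n → VertexSet n
  insert b S = updateAt S b (λ _ → true)

  ∈-insert-new : ∀ b S → b ∈ᵛ insert b S
  ∈-insert-new b S = updateAt-updates b S

  ∈-insert-old : ∀ {b v} S → v ∈ᵛ S → v ∈ᵛ insert b S
  ∈-insert-old {b} {v} S v∈S with v ≟ b
  ... | yes refl = updateAt-updates b S
  ... | no v≢b   = trans (updateAt-minimal v b S v≢b) v∈S

  ∈-insert⁻ : ∀ {b v} S → v ∈ᵛ insert b S → v ≡ b ⊎ v ∈ᵛ S
  ∈-insert⁻ {b} {v} S v∈S' with v ≟ b
  ... | yes v≡b = inj₁ v≡b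
  ... | no v≢b  = inj₂ (trans (sym (updateAt-minimal v b S v≢b)) v∈S')

  card : VertexSet n → ℕ
  card S = length (filter (_∈ᵛ? S) (allFin n))

  card-insert : ∀ {b} S → ¬ b ∈ᵛ S → card (insert b S) ≡ suc (card S)
  card-insert {b} S b∉S = begin
    card (insert b S)                        ≡⟨ length-filter-⊆ _ _ (∈-insert-old S) (allFin n) ⟩
    card S + length (filter new? (allFin n)) ≡⟨ cong (card S +_) only-b-new ⟩
    card S + 1                               ≡⟨ +-comm (card S) 1 ⟩
    suc (card S)                             ∎
    where
      open ≡-Reasoning
      new? : Decidable (λ v → v ∈ᵛ insert b S × ¬ v ∈ᵛ S)
      new? = (_∈ᵛ? insert b S) ∩? ∁? (_∈ᵛ? S)
      only-b : ∀ {v} → v ∈ᵛ insert b S × ¬ v ∈ᵛ S → v ≡ b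
      only-b (v∈S' , v∉S) with ∈-insert⁻ S v∈S'
      ... | inj₁ v≡b = v≡b
      ... | inj₂ v∈S = contradiction v∈S v∉S
      only-b-new : length (filter new? (allFin n)) ≡ 1
      only-b-new = length-filter-≡1 new? (allFin⁺ n) (∈-allFin b) (∈-insert-new b S , b∉S) only-b

  ∅ : VertexSet n
  ∅ _ = false

  ⁅_⁆ : Fin n → VertexSet n
  ⁅ v ⁆ = insert v ∅

  ∈-⁅⁆ : ∀ v → v ∈ᵛ ⁅ v ⁆
  ∈-⁅⁆ v = ∈-insert-new v ∅

  ∈-⁅⁆⁻ : ∀ {u} v → u ∈ᵛ ⁅ v ⁆ → u ≡ v
  ∈-⁅⁆⁻ v u∈ with ∈-insert⁻ ∅ u∈
  ... | inj₁ u≡v = u≡v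

  card-∅ : card ∅ ≡ 0
  card-∅ = length-filter-none (_∈ᵛ? ∅) (universal (λ _ ()) (allFin n))

  card-⁅⁆ : ∀ v → card ⁅ v ⁆ ≡ 1
  card-⁅⁆ v = trans (card-insert ∅ (λ ())) (cong suc card-∅)

  card-full : ∀ {S} → (∀ v → v ∈ᵛ S) → card S ≡ n
  card-full {S} full = trans (cong length (filter-all (_∈ᵛ? S) (universal full (allFin n)))) (length-tabulate id)

  card≡n⇒full : ∀ S → card S ≡ n → ∀ v → v ∈ᵛ S
  card≡n⇒full S card≡n v = decidable-stable (v ∈ᵛ? S) λ v∉S →
    <-irrefl (trans card≡n (sym (length-tabulate id)))
             (filter-notAll (_∈ᵛ? S) (allFin n) (Any.map (λ { refl → v∉S }) (∈-allFin v)))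

  card<n⇒∃∉ : ∀ S → card S < n → ∃ λ v → ¬ v ∈ᵛ S
  card<n⇒∃∉ S card<n with any? (λ v → ¬? (v ∈ᵛ? S))
  ... | yes ∃∉ = ∃∉
  ... | no ∄∉  = contradiction card<n (<-irrefl (card-full all∈))
    where
      all∈ : ∀ v → v ∈ᵛ S
      all∈ v = decidable-stable (v ∈ᵛ? S) (∄∉ ∘ (v ,_))

  monochrome : Fin n → Fin 1
  monochrome _ = zero

module _ {n : ℕ} (G : Graph n) where

  Adj-sym : ∀ {u v} → Adj G u v → Adj G v u
  Adj-sym {u} {v} uv = trans (sym (adj-sym G u v)) uv

  pairs : List (Fin n × Fin n)
  pairs = cartesianProduct (allFin n) (allFin n)

  -- Each edge is seen once, as the pair (u , v) with u < v; MonoEdge c is the predicate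
  -- that badEdges G c counts.
  MonoEdge : ∀ {ℓ} → (Fin n → Fin ℓ) → Pred (Fin n × Fin n) 0ℓ
  MonoEdge c (u , v) = u <ᶠ v × Adj G u v × c u ≡ c v

  monoEdge? : ∀ {ℓ} (c : Fin n → Fin ℓ) → Decidable (MonoEdge c)
  monoEdge? c (u , v) = (u <ᶠ? v) ×-dec (adj G u v ≟ᵇ true) ×-dec (c u ≟ c v)

  MonoEdgeIn : ∀ {ℓ} → VertexSet n → (Fin n → Fin ℓ) → Pred (Fin n × Fin n) 0ℓ
  MonoEdgeIn S c (u , v) = MonoEdge c (u , v) × u ∈ᵛ S × v ∈ᵛ S

  monoEdgeIn? : ∀ {ℓ} S (c : Fin n → Fin ℓ) → Decidable (MonoEdgeIn S c)
  monoEdgeIn? S c (u , v) = monoEdge? c (u , v) ×-dec (u ∈ᵛ? S) ×-dec (v ∈ᵛ? S)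

  monoEdgesIn : ∀ {ℓ} → VertexSet n → (Fin n → Fin ℓ) → ℕ
  monoEdgesIn S c = length (filter (monoEdgeIn? S c) pairs)

  monoEdgesIn-full : ∀ {ℓ} {S} (c : Fin n → Fin ℓ) → (∀ v → v ∈ᵛ S) → monoEdgesIn S c ≡ badEdges G c
  monoEdgesIn-full c full =
    cong length (filter-≐ (monoEdgeIn? _ c) (monoEdge? c) (proj₁ , λ e → e , full _ , full _) pairs)

  monoEdgesIn-cong : ∀ {ℓ} S {c c' : Fin n → Fin ℓ} → (∀ {v} → v ∈ᵛ S → c v ≡ c' v) →
                     monoEdgesIn S c ≡ monoEdgesIn S c'
  monoEdgesIn-cong S c≗c' =
    cong length (filter-≐ (monoEdgeIn? S _) (monoEdgeIn? S _) (to c≗c' , to (sym ∘ c≗c')) pairs)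
    where
      to : ∀ {c c'} → (∀ {v} → v ∈ᵛ S → c v ≡ c' v) → MonoEdgeIn S c ⊆ MonoEdgeIn S c'
      to c≗c' ((u<v , uv , cu≡cv) , u∈S , v∈S) =
        (u<v , uv , trans (sym (c≗c' u∈S)) (trans cu≡cv (c≗c' v∈S))) , u∈S , v∈S

  record Pendant (S : VertexSet n) (a b : Fin n) : Set where
    field
      parent∈       : a ∈ᵛ S
      leaf∉         : ¬ b ∈ᵛ S
      edge          : Adj G a b
      parent-unique : ∀ {y} → y ∈ᵛ S → Adj G b y → y ≡ a

  module _ {S a b} (pendant : Pendant S a b) {ℓ} (c : Fin n → Fin ℓ) where
    open Pendant pendant

    private
      NewMonoEdge : Pred (Fin n × Fin n) 0ℓ
      NewMonoEdge = MonoEdgeIn (insert b S) c ∩ ∁ (MonoEdgeIn S c)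

      newMonoEdge? : Decidable NewMonoEdge
      newMonoEdge? = monoEdgeIn? (insert b S) c ∩? ∁? (monoEdgeIn? S c)

      newMonoEdges : ℕ
      newMonoEdges = length (filter newMonoEdge? pairs)

      monoEdgesIn-insert : monoEdgesIn (insert b S) c ≡ monoEdgesIn S c + newMonoEdges
      monoEdgesIn-insert = length-filter-⊆ _ _
        (λ (e , u∈S , v∈S) → e , ∈-insert-old S u∈S , ∈-insert-old S v∈S) pairs

      ordered : ∀ {u v} → NewMonoEdge (u , v) → u <ᶠ v
      ordered (((u<v , _) , _) , _) = u<v

      newMonoEdge⇒ : ∀ {u v} → NewMonoEdge (u , v) → (u ≡ a × v ≡ b) ⊎ (u ≡ b × v ≡ a)
      newMonoEdge⇒ (((u<v , uv , cu≡cv) , u∈S' , v∈S') , old) with ∈-insert⁻ S u∈S' | ∈-insert⁻ S v∈S'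
      ... | inj₁ refl | inj₁ refl = contradiction u<v (<ᶠ-irrefl refl)
      ... | inj₁ refl | inj₂ v∈S  = inj₂ (refl , parent-unique v∈S uv)
      ... | inj₂ u∈S  | inj₁ refl = inj₁ (parent-unique u∈S (Adj-sym uv) , refl)
      ... | inj₂ u∈S  | inj₂ v∈S  = contradiction ((u<v , uv , cu≡cv) , u∈S , v∈S) old

    monoEdgesIn-insert-same : c a ≡ c b → monoEdgesIn (insert b S) c ≡ suc (monoEdgesIn S c)
    monoEdgesIn-insert-same ca≡cb = begin
      monoEdgesIn (insert b S) c     ≡⟨ monoEdgesIn-insert ⟩
      monoEdgesIn S c + newMonoEdges ≡⟨ cong (monoEdgesIn S c +_) (one newMonoEdge) ⟩
      monoEdgesIn S c + 1            ≡⟨ +-comm _ 1 ⟩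
      suc (monoEdgesIn S c)          ∎
      where
        open ≡-Reasoning
        new : ∀ {u v} → u <ᶠ v → (u ≡ a × v ≡ b) ⊎ (u ≡ b × v ≡ a) → NewMonoEdge (u , v)
        new u<v (inj₁ (refl , refl)) =
          ((u<v , edge , ca≡cb) , ∈-insert-old S parent∈ , ∈-insert-new b S) , leaf∉ ∘ proj₂ ∘ proj₂
        new u<v (inj₂ (refl , refl)) =
          ((u<v , Adj-sym edge , sym ca≡cb) , ∈-insert-new b S , ∈-insert-old S parent∈) , leaf∉ ∘ proj₁ ∘ proj₂

        newMonoEdge : ∃₂ λ u v → NewMonoEdge (u , v)
        newMonoEdge with <-cmp a b
        ... | tri< a<b _ _ = a , b , new a<b (inj₁ (refl , refl))
        ... | tri≈ _ refl _ = contradiction parent∈ leaf∉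
        ... | tri> _ _ b<a = b , a , new b<a (inj₂ (refl , refl))

        sameOrientation : ∀ {u v u' v'} → NewMonoEdge (u , v) → NewMonoEdge (u' , v') → (u' , v') ≡ (u , v)
        sameOrientation new new' with newMonoEdge⇒ new | newMonoEdge⇒ new'
        ... | inj₁ (refl , refl) | inj₁ (refl , refl) = refl
        ... | inj₂ (refl , refl) | inj₂ (refl , refl) = refl
        ... | inj₁ (refl , refl) | inj₂ (refl , refl) = contradiction (ordered new) (<-asym (ordered new'))
        ... | inj₂ (refl , refl) | inj₁ (refl , refl) = contradiction (ordered new) (<-asym (ordered new'))

        one : (∃₂ λ u v → NewMonoEdge (u , v)) → newMonoEdges ≡ 1
        one (u , v , uv-new) = length-filter-≡1 newMonoEdge? (cartesianProduct⁺ (allFin⁺ n) (allFin⁺ n))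
          (∈-cartesianProduct⁺ (∈-allFin u) (∈-allFin v)) uv-new (sameOrientation uv-new)

    monoEdgesIn-insert-diff : c a ≢ c b → monoEdgesIn (insert b S) c ≡ monoEdgesIn S c
    monoEdgesIn-insert-diff ca≢cb = begin
      monoEdgesIn (insert b S) c     ≡⟨ monoEdgesIn-insert ⟩
      monoEdgesIn S c + newMonoEdges ≡⟨ cong (monoEdgesIn S c +_) (length-filter-none _ (universal noNew pairs)) ⟩
      monoEdgesIn S c + 0            ≡⟨ +-identityʳ _ ⟩
      monoEdgesIn S c                ∎
      where
        open ≡-Reasoning
        noNew : ∀ e → ¬ NewMonoEdge e
        noNew (u , v) new@(((_ , _ , cu≡cv) , _) , _) with newMonoEdge⇒ new
        ... | inj₁ (refl , refl) = ca≢cb cu≡cv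
        ... | inj₂ (refl , refl) = ca≢cb (sym cu≡cv)

  -- A path inside S, indexed by its list of vertices, so that a simple path is one whose
  -- index is Unique.
  data PathIn (S : VertexSet n) : Fin n → Fin n → List (Fin n) → Set where
    end  : ∀ {v} → v ∈ᵛ S → PathIn S v v (v ∷ [])
    step : ∀ {u v w xs} → u ∈ᵛ S → Adj G u v → PathIn S v w xs → PathIn S u w (u ∷ xs)

  module _ {S : VertexSet n} where

    PathIn-all∈ : ∀ {u v xs} → PathIn S u v xs → All (_∈ᵛ S) xs
    PathIn-all∈ (end u∈S)      = u∈S ∷ []
    PathIn-all∈ (step u∈S _ p) = u∈S ∷ PathIn-all∈ p

    _++ᵖ_ : ∀ {u v w xs ys} → PathIn S u v xs → PathIn S v w ys → ∃ (PathIn S u w)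
    end _        ++ᵖ q = _ , q
    step u∈S e p ++ᵖ q = _ , step u∈S e (proj₂ (p ++ᵖ q))

    PathIn-weaken : ∀ {S'} → (∀ {v} → v ∈ᵛ S → v ∈ᵛ S') →
                    ∀ {u v xs} → PathIn S u v xs → PathIn S' u v xs
    PathIn-weaken S⊆S' (end v∈S)      = end (S⊆S' v∈S)
    PathIn-weaken S⊆S' (step u∈S e p) = step (S⊆S' u∈S) e (PathIn-weaken S⊆S' p)

    SimplePathIn : Fin n → Fin n → Set
    SimplePathIn u v = ∃ λ xs → PathIn S u v xs × Unique xs

    suffix : ∀ {u v w xs} → PathIn S v w xs → Unique xs → u ∈ xs → SimplePathIn u w
    suffix p@(end _)      !xs       (here refl)  = _ , p , !xs
    suffix p@(step _ _ _) !xs       (here refl)  = _ , p , !xs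
    suffix (step _ _ p)   (_ ∷ !xs) (there u∈xs) = suffix p !xs u∈xs

    simplify : ∀ {u v xs} → PathIn S u v xs → SimplePathIn u v
    simplify (end u∈S) = _ , end u∈S , [] ∷ []
    simplify (step {u} u∈S e p) with simplify p
    ... | ys , q , !ys with Any.any? (u ≟_) ys
    ...   | yes u∈ys = suffix q !ys u∈ys
    ...   | no u∉ys  = u ∷ ys , step u∈S e q , ¬Any⇒All¬ ys u∉ys ∷ !ys

    PathIn-adjacent : ∀ {u v x zs} → PathIn S u v (u ∷ x ∷ zs) → (i : Fin (suc (length zs))) →
                      Adj G (lookup (u ∷ x ∷ zs) (inject₁ i)) (lookup (u ∷ x ∷ zs) (suc i))
    PathIn-adjacent (step _ e (end _))      zero = e
    PathIn-adjacent (step _ e (step _ _ _)) zero = e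
    PathIn-adjacent {zs = _ ∷ _} (step _ _ p@(step _ _ _)) (suc i) = PathIn-adjacent p i

    PathIn-last : ∀ {u v xs} → PathIn S u v (u ∷ xs) → lookup (u ∷ xs) (fromℕ (length xs)) ≡ v
    PathIn-last (end _)                  = refl
    PathIn-last (step _ _ (end _))       = refl
    PathIn-last (step _ _ p@(step _ _ _)) = PathIn-last p

    closeCycle : ∀ {w u v x zs} → ¬ w ∈ᵛ S → Adj G w u → Adj G w v →
                 PathIn S u v (u ∷ x ∷ zs) → Unique (u ∷ x ∷ zs) → Cycle G
    closeCycle {w} {u} {v} {x} {zs} w∉S wu wv p !p = record
      { m     = length zs
      ; vtx   = lookup (w ∷ u ∷ x ∷ zs)
      ; inj   = lookup-injective (All.map (λ y∈S → λ { refl → w∉S y∈S }) (PathIn-all∈ p) ∷ !p)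
      ; cons  = λ { zero → wu ; (suc i) → PathIn-adjacent p i }
      ; close = subst (λ y → Adj G y w) (sym (PathIn-last p)) (Adj-sym wv)
      }

  acyclic⇒joined-neighbours-equal : Acyclic G → ∀ {S w u v xs} → ¬ w ∈ᵛ S → Adj G w u → Adj G w v →
                                     PathIn S u v xs → Unique xs → u ≡ v
  acyclic⇒joined-neighbours-equal acyclic w∉S wu wv (end _) _ = refl
  acyclic⇒joined-neighbours-equal acyclic w∉S wu wv p@(step _ _ (end _)) !p =
    contradiction (closeCycle w∉S wu wv p !p) acyclic
  acyclic⇒joined-neighbours-equal acyclic w∉S wu wv p@(step _ _ (step _ _ _)) !p =
    contradiction (closeCycle w∉S wu wv p !p) acyclic

  boundaryEdge : ∀ {S u x} → Walk G u x → u ∈ᵛ S → ¬ x ∈ᵛ S →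
                 ∃₂ λ a b → a ∈ᵛ S × ¬ b ∈ᵛ S × Adj G a b
  boundaryEdge stay u∈S u∉S = contradiction u∈S u∉S
  boundaryEdge {S} (step {v = v} uv w) u∈S x∉S with v ∈ᵛ? S
  ... | yes v∈S = boundaryEdge w v∈S x∉S
  ... | no v∉S  = _ , _ , u∈S , v∉S , uv

  InternallyConnected : VertexSet n → Set
  InternallyConnected S = ∀ {u v} → u ∈ᵛ S → v ∈ᵛ S → ∃ (PathIn S u v)

  pendant : Acyclic G → ∀ {S a b} → InternallyConnected S →
            a ∈ᵛ S → ¬ b ∈ᵛ S → Adj G a b → Pendant S a b
  pendant acyclic {S} {a} {b} connected a∈S b∉S ab = record
    { parent∈       = a∈S
    ; leaf∉         = b∉S
    ; edge          = ab
    ; parent-unique = λ y∈S by →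
        let (_ , p , !p) = simplify (proj₂ (connected y∈S a∈S))
        in  acyclic⇒joined-neighbours-equal acyclic b∉S by (Adj-sym ab) p !p
    }

  module _ (r : Fin n) where

    record Subtree (t : ℕ) : Set where
      field
        vertices   : VertexSet n
        root∈      : r ∈ᵛ vertices
        card≡      : card vertices ≡ suc t
        connected  : InternallyConnected vertices
        -- with a single colour every edge is monochromatic: the subtree has t edges
        edges≡     : monoEdgesIn vertices monochrome ≡ t
        realisable : ∀ {j} → j ≤ t → ∃ λ (c : Fin n → Fin 2) → monoEdgesIn vertices c ≡ j

    root-subtree : Subtree 0
    root-subtree = record
      { vertices   = ⁅ r ⁆
      ; root∈      = ∈-⁅⁆ r
      ; card≡      = card-⁅⁆ r
      ; connected  = connected
      ; edges≡     = noEdges monochrome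
      ; realisable = λ { z≤n → (λ _ → zero) , noEdges _ }
      }
      where
        connected : InternallyConnected ⁅ r ⁆
        connected u∈ v∈ with ∈-⁅⁆⁻ r u∈ | ∈-⁅⁆⁻ r v∈
        ... | refl | refl = _ , end (∈-⁅⁆ r)

        noEdges : ∀ {ℓ} (c : Fin n → Fin ℓ) → monoEdgesIn ⁅ r ⁆ c ≡ 0
        noEdges c = length-filter-none _ (universal (λ { (u , v) ((u<v , _) , u∈ , v∈) →
                      <ᶠ-irrefl (trans (∈-⁅⁆⁻ r u∈) (sym (∈-⁅⁆⁻ r v∈))) u<v }) pairs)

    attach : ∀ {t a b} (T : Subtree t) → Pendant (Subtree.vertices T) a b → Subtree (suc t)
    attach {t} {a} {b} T leaf = record
      { vertices   = S'
      ; root∈      = ∈-insert-old S root∈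
      ; card≡      = trans (card-insert S leaf∉) (cong suc card≡)
      ; connected  = connected'
      ; edges≡     = trans (monoEdgesIn-insert-same leaf monochrome refl) (cong suc edges≡)
      ; realisable = realisable'
      }
      where
        open Subtree T renaming (vertices to S)
        open Pendant leaf
        S' = insert b S

        inS' : ∀ {u v xs} → PathIn S u v xs → PathIn S' u v xs
        inS' = PathIn-weaken (∈-insert-old S)

        connected' : InternallyConnected S'
        connected' u∈ v∈ with ∈-insert⁻ S u∈ | ∈-insert⁻ S v∈
        ... | inj₁ refl | inj₁ refl = _ , end u∈
        ... | inj₁ refl | inj₂ v∈S  = _ , step u∈ (Adj-sym edge) (inS' (proj₂ (connected parent∈ v∈S)))
        ... | inj₂ u∈S  | inj₁ refl =
          inS' (proj₂ (connected u∈S parent∈)) ++ᵖ step (∈-insert-old S parent∈) edge (end v∈)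
        ... | inj₂ u∈S  | inj₂ v∈S  = _ , inS' (proj₂ (connected u∈S v∈S))

        colourLeaf : (Fin n → Fin 2) → Fin 2 → Fin n → Fin 2
        colourLeaf c x = updateAt c b (λ _ → x)

        colourLeaf-parent : ∀ c x → colourLeaf c x a ≡ c a
        colourLeaf-parent c x = updateAt-minimal a b c (λ { refl → leaf∉ parent∈ })

        colourLeaf-leaf : ∀ c x → colourLeaf c x b ≡ x
        colourLeaf-leaf c x = updateAt-updates b c

        monoEdgesIn-colourLeaf : ∀ c x → monoEdgesIn S (colourLeaf c x) ≡ monoEdgesIn S c
        monoEdgesIn-colourLeaf c x = monoEdgesIn-cong S (λ v∈S → updateAt-minimal _ b c (λ { refl → leaf∉ v∈S }))

        leafOtherColour : ∀ {j} → ∃ (λ c → monoEdgesIn S c ≡ j) → ∃ λ c → monoEdgesIn S' c ≡ j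
        leafOtherColour {j} (c , c≡j) = c' , (begin
          monoEdgesIn S' c' ≡⟨ monoEdgesIn-insert-diff leaf c' c'a≢c'b ⟩
          monoEdgesIn S c'  ≡⟨ monoEdgesIn-colourLeaf c _ ⟩
          monoEdgesIn S c   ≡⟨ c≡j ⟩
          j                 ∎)
          where
            open ≡-Reasoning
            c' = colourLeaf c (other (c a))
            c'a≢c'b : c' a ≢ c' b
            c'a≢c'b eq = other-≢ (c a) (trans (sym (colourLeaf-parent c _)) (trans eq (colourLeaf-leaf c _)))

        leafParentColour : ∀ {j} → ∃ (λ c → monoEdgesIn S c ≡ j) → ∃ λ c → monoEdgesIn S' c ≡ suc j
        leafParentColour {j} (c , c≡j) = c' , (begin
          monoEdgesIn S' c'      ≡⟨ monoEdgesIn-insert-same leaf c' c'a≡c'b ⟩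
          suc (monoEdgesIn S c') ≡⟨ cong suc (monoEdgesIn-colourLeaf c _) ⟩
          suc (monoEdgesIn S c)  ≡⟨ cong suc c≡j ⟩
          suc j                  ∎)
          where
            open ≡-Reasoning
            c' = colourLeaf c (c a)
            c'a≡c'b : c' a ≡ c' b
            c'a≡c'b = trans (colourLeaf-parent c _) (sym (colourLeaf-leaf c _))

        realisable' : ∀ {j} → j ≤ suc t → ∃ λ (c : Fin n → Fin 2) → monoEdgesIn S' c ≡ j
        realisable' j≤t+1 with m≤n⇒m<n∨m≡n j≤t+1
        ... | inj₁ (s≤s j≤t) = leafOtherColour (realisable j≤t)
        ... | inj₂ refl      = leafParentColour (realisable ≤-refl)

    extend : IsTree G → ∀ {t} → Subtree t → suc t < n → Subtree (suc t)
    extend (connected-G , acyclic) T t+1<n =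
      let (x , x∉S)                = card<n⇒∃∉ S (subst (_< n) (sym card≡) t+1<n)
          (a , b , a∈S , b∉S , ab) = boundaryEdge {S} (connected-G r x) root∈ x∉S
      in  attach T (pendant acyclic connected a∈S b∉S ab)
      where open Subtree T renaming (vertices to S)

    grow : IsTree G → ∀ t → t < n → Subtree t
    grow tree zero    _     = root-subtree
    grow tree (suc t) t+1<n = extend tree (grow tree t (<⇒≤ t+1<n)) t+1<n

module _ {m : ℕ} (T : Graph (suc m)) (tree : IsTree T) where

  private
    spanning : Subtree T zero m
    spanning = grow T zero tree m ≤-refl

    open Subtree spanning

    all∈ : ∀ v → v ∈ᵛ vertices
    all∈ = card≡n⇒full vertices card≡

  tree-hasColoring : ∀ {k} → k ≤ m → HasColoring T k 2
  tree-hasColoring k≤m =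
    let (c , c≡k) = realisable k≤m in c , trans (sym (monoEdgesIn-full T c all∈)) c≡k

  tree-monochromatic : (c : Fin (suc m) → Fin 1) → badEdges T c ≡ m
  tree-monochromatic c = begin
    badEdges T c                      ≡⟨ monoEdgesIn-full T c all∈ ⟨
    monoEdgesIn T vertices c          ≡⟨ monoEdgesIn-cong T vertices (λ {v} _ → Fin1-≡ (c v)) ⟩
    monoEdgesIn T vertices monochrome ≡⟨ edges≡ ⟩
    m                                 ∎
    where
      open ≡-Reasoning
      Fin1-≡ : (x : Fin 1) → x ≡ zero
      Fin1-≡ zero = refl

defectNumber-tree : ∀ {n k} (T : Graph n) → IsTree T → suc (suc k) ≤ n → DefectNumber T k 2
defectNumber-tree {suc m} T tree (s≤s k<m) = tree-hasColoring T tree (<⇒≤ k<m) , noMonochromatic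
  where
    noMonochromatic : ∀ ℓ → 1 ≤ ℓ → ℓ < 2 → ¬ HasColoring T _ ℓ
    noMonochromatic 1 _ _ (c , c≡k) = <-irrefl (trans (sym c≡k) (tree-monochromatic T tree c)) k<m
    noMonochromatic (suc (suc _)) _ (s≤s (s≤s ()))

mainTheorem2 : (n : ℕ) (T : Graph n) → IsTree T →
               (k : ℕ) → k + 2 ≤ n → DefectNumber T k 2
mainTheorem2 n T tree k k+2≤n = defectNumber-tree T tree (subst (_≤ n) (+-comm k 2) k+2≤n)
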